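{- For every diagram $D$, $\mathrm{MC}(D)=\mathrm{rk}(D)$.
   Context: A diagram is a finite subset $D\subset\mathbb{Z}_{>0}\times\mathbb{Z}_{>0}$; $(r,c)\in D$ is a cell in row $r$, column $c$. Kohnert move at row $r$: if row $r$ is empty, $\mathcal{K}(D,r)=D$; otherwise let $(r,c)$ be the rightmost cell of row $r$; if some $r'<r$ has $(r',c)\notin D$, take the largest such $r'$ and set $\mathcal{K}(D,r)=(D\setminus\{(r,c)\})\cup\{(r',c)\}$; else $\mathcal{K}(D,r)=D$. A move is nontrivial if it changes the diagram. $\mathrm{KD}(D)$ is the set of diagrams obtainable from $D$ by finite sequences of Kohnert moves; $\mathrm{Min}(D)$ is the set of $\tilde D\in\mathrm{KD}(D)$ fixed by all Kohnert moves. $\mathrm{MC}(D)$ is the maximum, over $\tilde D\in \mathrm{Min}(D)$, of the number of moves in a sequence of nontrivial Kohnert moves transforming $D$ into $\tilde D$. The Kohnert poset $\mathcal{P}(D)$ is $\mathrm{KD}(D)$ ordered by $D_2\preceq D_1$ iff $D_2$ is obtainable from $D_1$ by a sequence of Kohnert moves. $\mathrm{rk}(D)$ is one less than the maximum cardinality of a chain (totally ordered subset) of $\mathcal{P}(D)$. -}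

module Defs where

open import Data.Nat using (ℕ; suc; _≤_; _<_)
open import Data.Product using (_×_; Σ; ∃; ∃-syntax; _,_)
open import Data.Sum using (_⊎_)
open import Data.List using (List; length)
open import Data.List.Membership.Propositional using (_∈_; _∉_)
open import Data.List.Relation.Unary.All using (All)
open import Data.List.Relation.Unary.AllPairs using (AllPairs)
open import Relation.Nullary using (¬_)
open import Relation.Binary.PropositionalEquality using (_≡_; _≢_)

-- A cell (r , c): row r, column c.
Cell : Set
Cell = ℕ × ℕ

-- A (finite) diagram is given by a list of cells; only the underlying SET matters.
Diagram : Set
Diagram = List Cell

IsDiagram : Diagram → Set
IsDiagram D = All (λ { (r , c) → 1 ≤ r × 1 ≤ c }) D

_≈_ : Diagram → Diagram → Set
D ≈ E = ∀ x → (x ∈ D → x ∈ E) × (x ∈ E → x ∈ D)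

-- NonTrivMove D r E : the Kohnert move at row r is nontrivial on D and K(D,r) = E.
record NonTrivMove (D : Diagram) (r : ℕ) (E : Diagram) : Set where
  field
    c          : ℕ
    inRow      : (r , c) ∈ D
    rightmost  : ∀ c' → c < c' → (r , c') ∉ D
    r'         : ℕ
    r'-pos     : 1 ≤ r'
    r'<r       : r' < r
    r'-empty   : (r' , c) ∉ D
    r'-largest : ∀ r'' → r' < r'' → r'' < r → (r'' , c) ∈ D
    result     : ∀ x → (x ∈ E → ((x ∈ D × x ≢ (r , c)) ⊎ x ≡ (r' , c)))
                     × (((x ∈ D × x ≢ (r , c)) ⊎ x ≡ (r' , c)) → x ∈ E)

Step : Diagram → Diagram → Set
Step D E = ∃[ r ] NonTrivMove D r E

IsMinimal : Diagram → Set
IsMinimal D = ∀ r E → ¬ NonTrivMove D r E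

-- Obtainable by a finite sequence of Kohnert moves (trivial moves change nothing).
data Reach : Diagram → Diagram → Set where
  done : ∀ {D E} → D ≈ E → Reach D E
  step : ∀ {D E F} → Step D E → Reach E F → Reach D F

data Path : Diagram → Diagram → ℕ → Set where
  done : ∀ {D E} → D ≈ E → Path D E 0
  step : ∀ {D E F k} → Step D E → Path E F k → Path D F (suc k)

MCLength : Diagram → ℕ → Set
MCLength D k = ∃[ E ] (IsMinimal E × Path D E k)

-- A chain of the Kohnert poset P(D): a list of distinct elements of KD(D),
-- pairwise comparable (E₂ ⪯ E₁ iff Reach E₁ E₂).
IsChain : Diagram → List Diagram → Set
IsChain D cs = All (Reach D) cs
             × AllPairs (λ E F → ¬ (E ≈ F) × (Reach E F ⊎ Reach F E)) cs

ChainCard : Diagram → ℕ → Set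
ChainCard D n = ∃[ cs ] (IsChain D cs × length cs ≡ n)

IsMax : (ℕ → Set) → ℕ → Set
IsMax P n = P n × (∀ m → P m → m ≤ n)

{-# OPTIONS --safe #-}
module Submission where

-- A nontrivial Kohnert move lowers the sum of the row indices of the cells, and each row
-- admits at most one move, so by well-founded recursion every diagram D has a height: the
-- largest length of a sequence of nontrivial moves starting at D, attained by one that ends
-- in a minimal diagram. Height strictly decreases along moves, so distinct comparable elements
-- of P(D) have distinct heights in [0, height D] and a chain has at most height D + 1
-- elements; the diagrams visited by a longest move sequence form a chain of exactly that size.

open import Defs
open import Data.Empty using (⊥-elim)
open import Data.Fin using (Fin; zero; suc; toℕ; fromℕ<) renaming (_<_ to _<ᶠ_)
open import Data.Fin.Properties using (pigeonhole; toℕ-fromℕ<)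
open import Data.List using (List; []; _∷_; length; map; filter; lookup)
open import Data.List.Extrema.Nat using (argmax; f[⊥]≤f[argmax]; f[xs]≤f[argmax])
open import Data.List.Membership.Propositional using (_∈_; _∉_; find)
open import Data.List.Membership.Propositional.Properties
  using (∈-map⁺; ∈-filter⁺; ∈-filter⁻; ∈-lookup)
open import Data.List.Relation.Unary.All as All using (All; []; _∷_)
open import Data.List.Relation.Unary.AllPairs as AllPairs using (AllPairs; []; _∷_)
open import Data.List.Relation.Unary.Any using (Any; here; there)
open import Data.List.Relation.Unary.Any.Properties using (¬Any[])
open import Data.Nat using (ℕ; zero; suc; _+_; _≤_; _<_; z≤n; s≤s; _≟_; _≤?_)
open import Data.Nat.Induction using (<-wellFounded)
open import Data.Nat.Properties
open import Data.Product as Product using (_×_; ∃; ∃-syntax; Σ; _,_; proj₁; proj₂)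
open import Data.Product.Properties using (≡-dec)
open import Data.Sum as Sum using (_⊎_; inj₁; inj₂)
open import Function using (_∘_)
import Induction.WellFounded as WF
open import Relation.Binary.Construct.On as On using ()
open import Relation.Binary.Definitions using (DecidableEquality)
open import Relation.Binary.PropositionalEquality
  using (_≡_; _≢_; refl; sym; cong; cong₂; subst; module ≡-Reasoning)
open import Relation.Nullary using (¬_; yes; no; ¬?)
open import Relation.Unary using (Decidable)
open import Algebra.Properties.CommutativeSemigroup +-commutativeSemigroup using (x∙yz≈y∙xz)

module NTM = NonTrivMove

_≟ᶜ_ : DecidableEquality Cell
_≟ᶜ_ = ≡-dec _≟_ _≟_

open import Data.List.Membership.DecPropositional _≟ᶜ_ using (_∈?_)

≈-refl : ∀ {D} → D ≈ D
≈-refl x = (λ p → p) , (λ p → p)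

≈-reflexive : ∀ {D E} → D ≡ E → D ≈ E
≈-reflexive refl = ≈-refl

≈-sym : ∀ {D E} → D ≈ E → E ≈ D
≈-sym e x = proj₂ (e x) , proj₁ (e x)

≈-trans : ∀ {D E F} → D ≈ E → E ≈ F → D ≈ F
≈-trans e f x = proj₁ (f x) ∘ proj₁ (e x) , proj₂ (e x) ∘ proj₂ (f x)

NonTrivMove-resp-≈ : ∀ {D D' r E} → D ≈ D' → NonTrivMove D r E → NonTrivMove D' r E
NonTrivMove-resp-≈ {D} {D'} e m = record
  { c          = c
  ; inRow      = to inRow
  ; rightmost  = λ c' c<c' → rightmost c' c<c' ∘ from
  ; r'         = r'
  ; r'-pos     = r'-pos
  ; r'<r       = r'<r
  ; r'-empty   = r'-empty ∘ from
  ; r'-largest = λ r'' lo hi → to (r'-largest r'' lo hi)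
  ; result     = λ x → Sum.map₁ (Product.map₁ to) ∘ proj₁ (result x)
                     , proj₂ (result x) ∘ Sum.map₁ (Product.map₁ from)
  }
  where
  open NonTrivMove m
  to : ∀ {x} → x ∈ D → x ∈ D'
  to = proj₁ (e _)
  from : ∀ {x} → x ∈ D' → x ∈ D
  from = proj₂ (e _)

-- A diagram may list a cell several times, so a move must delete every copy of it.
removeAll : Cell → Diagram → Diagram
removeAll x = filter (λ y → ¬? (y ≟ᶜ x))

moveCell : Cell → Cell → Diagram → Diagram
moveCell x y D = y ∷ removeAll x D

∈-moveCell⁻ : ∀ {x y z D} → z ∈ moveCell x y D → (z ∈ D × z ≢ x) ⊎ z ≡ y
∈-moveCell⁻ (here z≡y) = inj₂ z≡y
∈-moveCell⁻ {D = D} (there z∈) = inj₁ (∈-filter⁻ (λ y → ¬? (y ≟ᶜ _)) {xs = D} z∈)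

∈-moveCell⁺ : ∀ {x y z D} → (z ∈ D × z ≢ x) ⊎ z ≡ y → z ∈ moveCell x y D
∈-moveCell⁺ (inj₂ z≡y) = here z≡y
∈-moveCell⁺ (inj₁ (z∈D , z≢x)) = there (∈-filter⁺ (λ y → ¬? (y ≟ᶜ _)) z∈D z≢x)

NonTrivMove-≈ : ∀ {D r E} (m : NonTrivMove D r E) →
                E ≈ moveCell (r , NTM.c m) (NTM.r' m , NTM.c m) D
NonTrivMove-≈ m x = ∈-moveCell⁺ ∘ proj₁ (NTM.result m x) , proj₂ (NTM.result m x) ∘ ∈-moveCell⁻

column-≥ : ∀ {D r E c'} (m : NonTrivMove D r E) → (r , c') ∈ D → c' ≤ NTM.c m
column-≥ m rc'∈D = ≮⇒≥ λ c<c' → NTM.rightmost m _ c<c' rc'∈D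

column-unique : ∀ {D r E E'} (m : NonTrivMove D r E) (m' : NonTrivMove D r E') →
                NTM.c m ≡ NTM.c m'
column-unique m m' = ≤-antisym (column-≥ m' (NTM.inRow m)) (column-≥ m (NTM.inRow m'))

target-≥ : ∀ {D r E E'} (m : NonTrivMove D r E) (m' : NonTrivMove D r E') →
           NTM.r' m' ≤ NTM.r' m
target-≥ {D} m m' = ≮⇒≥ λ r'<r'' → NTM.r'-empty m'
  (subst (λ c → (NTM.r' m' , c) ∈ D) (column-unique m m')
         (NTM.r'-largest m _ r'<r'' (NTM.r'<r m')))

NonTrivMove-unique : ∀ {D r E E'} → NonTrivMove D r E → NonTrivMove D r E' → E ≈ E'
NonTrivMove-unique {D} {r} m m' =
  ≈-trans (NonTrivMove-≈ m)
          (≈-trans (≈-reflexive (cong₂ (λ c r' → moveCell (r , c) (r' , c) D)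
                                       (column-unique m m')
                                       (≤-antisym (target-≥ m' m) (target-≥ m m'))))
                   (≈-sym (NonTrivMove-≈ m')))

rowSum : Diagram → ℕ
rowSum [] = 0
rowSum ((r , _) ∷ D) = r + rowSum D

rowSum-filter : ∀ {P : Cell → Set} (P? : Decidable P) D → rowSum (filter P? D) ≤ rowSum D
rowSum-filter P? [] = z≤n
rowSum-filter P? ((r , c) ∷ D) with P? (r , c)
... | yes _ = +-monoʳ-≤ r (rowSum-filter P? D)
... | no _  = ≤-trans (rowSum-filter P? D) (m≤n+m (rowSum D) r)

rowSum-removeAll : ∀ {x} D → x ∈ D → proj₁ x + rowSum (removeAll x D) ≤ rowSum D
rowSum-removeAll {x} ((r , c) ∷ D) x∈ with (r , c) ≟ᶜ x | x∈
... | yes refl | _ = +-monoʳ-≤ r (rowSum-filter _ D)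
... | no rc≢x | here x≡rc = ⊥-elim (rc≢x (sym x≡rc))
... | no rc≢x | there x∈D = begin
  proj₁ x + (r + rowSum (removeAll x D)) ≡⟨ x∙yz≈y∙xz (proj₁ x) r _ ⟩
  r + (proj₁ x + rowSum (removeAll x D)) ≤⟨ +-monoʳ-≤ r (rowSum-removeAll D x∈D) ⟩
  r + rowSum D                           ∎
  where open ≤-Reasoning

rowSum-moveCell : ∀ {r r' c D} → (r , c) ∈ D → r' < r →
                  rowSum (moveCell (r , c) (r' , c) D) < rowSum D
rowSum-moveCell {D = D} rc∈D r'<r =
  <-≤-trans (+-monoˡ-< _ r'<r) (rowSum-removeAll D rc∈D)

rightmostInRow : ∀ D r → (∀ c → (r , c) ∉ D)
                       ⊎ ∃[ c ] ((r , c) ∈ D × ∀ {c'} → (r , c') ∈ D → c' ≤ c)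
rightmostInRow [] r = inj₁ λ _ ()
rightmostInRow ((r₀ , c₀) ∷ D) r with r₀ ≟ r | rightmostInRow D r
... | no r₀≢r | inj₁ empty = inj₁ λ
  { _ (here refl) → r₀≢r refl ; c (there p) → empty c p }
... | no r₀≢r | inj₂ (c , rc∈D , max) = inj₂ (c , there rc∈D , λ
  { (here refl) → ⊥-elim (r₀≢r refl) ; (there p) → max p })
... | yes refl | inj₁ empty = inj₂ (c₀ , here refl , λ
  { (here refl) → ≤-refl ; (there p) → ⊥-elim (empty _ p) })
... | yes refl | inj₂ (c , rc∈D , max) with c₀ ≤? c
...   | yes c₀≤c = inj₂ (c , there rc∈D , λ
  { (here refl) → c₀≤c ; (there p) → max p })
...   | no c₀≰c = inj₂ (c₀ , here refl , λ
  { (here refl) → ≤-refl ; (there p) → ≤-trans (max p) (<⇒≤ (≰⇒> c₀≰c)) })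

module _ {Occupied : ℕ → Set} (occupied? : Decidable Occupied) where

  LastGapBelow : ℕ → ℕ → Set
  LastGapBelow s k = 1 ≤ k × k < s × ¬ Occupied k × (∀ j → k < j → j < s → Occupied j)

  FullBelow : ℕ → Set
  FullBelow s = ∀ j → 1 ≤ j → j < s → Occupied j

  private
    extend : ∀ {s j} → Occupied s → (j < s → Occupied j) → j < suc s → Occupied j
    extend occ below j<1+s with m<1+n⇒m<n∨m≡n j<1+s
    ... | inj₁ j<s  = below j<s
    ... | inj₂ refl = occ

  lastGap : ∀ s → ∃ (LastGapBelow s) ⊎ FullBelow s
  lastGap zero = inj₂ λ _ _ ()
  lastGap (suc zero) = inj₂ λ _ 1≤j j<1 → ⊥-elim (<⇒≱ j<1 1≤j)
  lastGap (suc (suc s)) with occupied? (suc s) | lastGap (suc s)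
  ... | no free | _ = inj₁ (suc s , s≤s z≤n , ≤-refl , free ,
                            λ j s<j j<2+s → ⊥-elim (<⇒≱ s<j (≤-pred j<2+s)))
  ... | yes occ | inj₁ (k , 1≤k , k<s , free , above) =
          inj₁ (k , 1≤k , m<n⇒m<1+n k<s , free , λ j k<j → extend occ (above j k<j))
  ... | yes occ | inj₂ full = inj₂ λ j 1≤j → extend occ (full j 1≤j)

-- rowSum is not invariant under ≈ (cells may be repeated), so the recursion below runs
-- over these canonical results; any other result of the same move is ≈ to it.
CanonicalMove : Diagram → ℕ → Set
CanonicalMove D r = Σ Diagram λ E → NonTrivMove D r E × rowSum E < rowSum D

canonicalMove : ∀ D r → CanonicalMove D r ⊎ (∀ E → ¬ NonTrivMove D r E)
canonicalMove D r with rightmostInRow D r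
... | inj₁ empty = inj₂ λ _ m → empty _ (NTM.inRow m)
... | inj₂ (c , rc∈D , max) with lastGap (λ j → (j , c) ∈? D) r
...   | inj₂ full = inj₂ λ _ m → NTM.r'-empty m
          (subst (λ c' → (NTM.r' m , c') ∈ D) (sym (column m))
                 (full _ (NTM.r'-pos m) (NTM.r'<r m)))
  where
  column : ∀ {E} (m : NonTrivMove D r E) → NTM.c m ≡ c
  column m = ≤-antisym (max (NTM.inRow m)) (column-≥ m rc∈D)
...   | inj₁ (r' , 1≤r' , r'<r , free , above) =
          inj₁ (moveCell (r , c) (r' , c) D , move , rowSum-moveCell rc∈D r'<r)
  where
  move : NonTrivMove D r (moveCell (r , c) (r' , c) D)
  move = record
    { c          = c
    ; inRow      = rc∈D
    ; rightmost  = λ c' c<c' rc'∈D → <⇒≱ c<c' (max rc'∈D)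
    ; r'         = r'
    ; r'-pos     = 1≤r'
    ; r'<r       = r'<r
    ; r'-empty   = free
    ; r'-largest = above
    ; result     = λ x → ∈-moveCell⁻ , ∈-moveCell⁺
    }

Successor : Diagram → Set
Successor D = Σ Diagram λ E → Step D E × rowSum E < rowSum D

CoversMoves : ∀ D → List ℕ → List (Successor D) → Set
CoversMoves D rs ss = ∀ {r E} → r ∈ rs → NonTrivMove D r E → Any (λ s → E ≈ proj₁ s) ss

successorsAt : ∀ D rs → ∃ (CoversMoves D rs)
successorsAt D [] = [] , λ ()
successorsAt D (r ∷ rs) with canonicalMove D r | successorsAt D rs
... | inj₁ (E , m , decreasing) | ss , covers = (E , (r , m) , decreasing) ∷ ss , λ
  { (here refl) m' → here (NonTrivMove-unique m' m) ; (there r∈) m' → there (covers r∈ m') }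
... | inj₂ none | ss , covers = ss , λ
  { (here refl) m' → ⊥-elim (none _ m') ; (there r∈) m' → covers r∈ m' }

successors : ∀ D → Σ (List (Successor D)) λ ss →
             ∀ {r E} → NonTrivMove D r E → Any (λ s → E ≈ proj₁ s) ss
successors D with successorsAt D (map proj₁ D)
... | ss , covers = ss , λ m → covers (∈-map⁺ proj₁ (NTM.inRow m)) m

Path-resp-≈ : ∀ {D D' F k} → D ≈ D' → Path D F k → Path D' F k
Path-resp-≈ e (done D≈F) = done (≈-trans (≈-sym e) D≈F)
Path-resp-≈ e (step (r , m) p) = step (r , NonTrivMove-resp-≈ e m) p

_++ᴾ_ : ∀ {D E F j k} → Path D E j → Path E F k → Path D F (j + k)
done D≈E ++ᴾ q = Path-resp-≈ (≈-sym D≈E) q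
step s p ++ᴾ q = step s (p ++ᴾ q)

Reach⇒Path : ∀ {D E} → Reach D E → ∃ (Path D E)
Reach⇒Path (done D≈E) = 0 , done D≈E
Reach⇒Path (step s r) = Product.map suc (step s) (Reach⇒Path r)

record Height (D : Diagram) : Set where
  field
    value    : ℕ
    attained : MCLength D value
    bound    : ∀ {F k} → Path D F k → k ≤ value

heightFrom : ∀ D → (∀ {E} → rowSum E < rowSum D → Height E) → Height D
heightFrom D ih with successors D
... | [] , covers = record
  { value    = 0
  ; attained = D , (λ _ _ m → ¬Any[] (covers m)) , done ≈-refl
  ; bound    = λ { (done _) → z≤n ; (step (_ , m) _) → ⊥-elim (¬Any[] (covers m)) }
  }
... | s ∷ ss , covers = record
  { value    = suc (heightAfter best)
  ; attained = let F , minimal , p = Height.attained (ih (proj₂ (proj₂ best)))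
               in F , minimal , step (proj₁ (proj₂ best)) p
  ; bound    = λ { (done _) → z≤n ; (step (_ , m) p) → s≤s (bound (covers m) p) }
  }
  where
  heightAfter : Successor D → ℕ
  heightAfter (_ , _ , decreasing) = Height.value (ih decreasing)

  best : Successor D
  best = argmax heightAfter s ss

  bestIsBest : All (λ s' → heightAfter s' ≤ heightAfter best) (s ∷ ss)
  bestIsBest = f[⊥]≤f[argmax] {f = heightAfter} s ss ∷ f[xs]≤f[argmax] {f = heightAfter} s ss

  bound : ∀ {E F k} → Any (λ s' → E ≈ proj₁ s') (s ∷ ss) → Path E F k → k ≤ heightAfter best
  bound E≈succ p with find E≈succ
  ... | (_ , _ , decreasing) , s'∈ , E≈s' =
    ≤-trans (Height.bound (ih decreasing) (Path-resp-≈ E≈s' p)) (All.lookup bestIsBest s'∈)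

heightOf : ∀ D → Height D
heightOf = WF.All.wfRec (On.wellFounded rowSum <-wellFounded) _ Height heightFrom

height : Diagram → ℕ
height D = Height.value (heightOf D)

height-path : ∀ {D E k} → Path D E k → k + height E ≤ height D
height-path {E = E} p with Height.attained (heightOf E)
... | _ , _ , q = Height.bound (heightOf _) (p ++ᴾ q)

height-resp-≈ : ∀ {D E} → D ≈ E → height D ≡ height E
height-resp-≈ D≈E = ≤-antisym (height-path (done (≈-sym D≈E))) (height-path (done D≈E))

height-step : ∀ {D E F} → Step D E → Reach E F → height F < height D
height-step {F = F} s r with Reach⇒Path r
... | k , p = ≤-trans (s≤s (m≤n+m (height F) k)) (height-path (step s p))

step-≉ : ∀ {D E F} → Step D E → Reach E F → ¬ D ≈ F
step-≉ s r D≈F = <-irrefl (sym (height-resp-≈ D≈F)) (height-step s r)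

height-reach : ∀ {D E} → Reach D E → height E ≤ height D
height-reach (done D≈E) = ≤-reflexive (height-resp-≈ (≈-sym D≈E))
height-reach (step s r) = <⇒≤ (height-step s r)

height-reach-≉ : ∀ {D E} → Reach D E → ¬ D ≈ E → height E < height D
height-reach-≉ (done D≈E) D≉E = ⊥-elim (D≉E D≈E)
height-reach-≉ (step s r) _   = height-step s r

height-≢ : ∀ {D E} → ¬ D ≈ E × (Reach D E ⊎ Reach E D) → height D ≢ height E
height-≢ (D≉E , inj₁ r) eq = <-irrefl (sym eq) (height-reach-≉ r D≉E)
height-≢ (D≉E , inj₂ r) eq = <-irrefl eq (height-reach-≉ r (D≉E ∘ ≈-sym))

visited : ∀ {D F k} → Path D F k → List Diagram
visited (done {D} _) = D ∷ []
visited (step {D} _ p) = D ∷ visited p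

length-visited : ∀ {D F k} (p : Path D F k) → length (visited p) ≡ suc k
length-visited (done _) = refl
length-visited (step _ p) = cong suc (length-visited p)

visited-isChain : ∀ {D F k} (p : Path D F k) → IsChain D (visited p)
visited-isChain (done _) = done ≈-refl ∷ [] , [] ∷ []
visited-isChain (step s p) with visited-isChain p
... | reachable , comparable =
  done ≈-refl ∷ All.map (step s) reachable ,
  All.map (λ r → step-≉ s r , inj₁ (step s r)) reachable ∷ comparable

AllPairs-lookup : ∀ {A : Set} {R : A → A → Set} {xs : List A} → AllPairs R xs →
                  ∀ {i j : Fin (length xs)} → i <ᶠ j → R (lookup xs i) (lookup xs j)
AllPairs-lookup (Rx ∷ _) {zero} {suc j} _ = All.lookup Rx (∈-lookup j)
AllPairs-lookup (_ ∷ Rxs) {suc i} {suc j} (s≤s i<j) = AllPairs-lookup Rxs i<j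

length≤-injective : ∀ {A : Set} (f : A → ℕ) {xs n} →
                    AllPairs (λ x y → f x ≢ f y) xs → All (λ x → f x < n) xs → length xs ≤ n
length≤-injective f {xs} {n} distinct bounded = ≮⇒≥ λ n<length →
  let i , j , i<j , gi≡gj = pigeonhole n<length g
  in AllPairs-lookup distinct i<j (sameValue i j gi≡gj)
  where
  g : Fin (length xs) → Fin n
  g i = fromℕ< (All.lookup bounded (∈-lookup i))
  sameValue : ∀ i j → g i ≡ g j → f (lookup xs i) ≡ f (lookup xs j)
  sameValue i j gi≡gj = begin
    f (lookup xs i) ≡⟨ sym (toℕ-fromℕ< _) ⟩
    toℕ (g i)       ≡⟨ cong toℕ gi≡gj ⟩
    toℕ (g j)       ≡⟨ toℕ-fromℕ< _ ⟩
    f (lookup xs j) ∎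
    where open ≡-Reasoning

lemma2p3 : ∀ (D : Diagram) → IsDiagram D →
             ∃[ n ] (IsMax (MCLength D) n × IsMax (ChainCard D) (suc n))
lemma2p3 D _ with Height.attained (heightOf D)
... | longest@(_ , _ , p) =
  height D ,
  (longest , λ { _ (_ , _ , q) → Height.bound (heightOf D) q }) ,
  (visited p , visited-isChain p , length-visited p) ,
  λ { _ (cs , (reachable , comparable) , refl) →
        length≤-injective height (AllPairs.map height-≢ comparable)
                                 (All.map (s≤s ∘ height-reach) reachable) }
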